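{- Let $a,b,r$ be integers and $m=ar+b$ with $1\leq b\leq a<m$. Then for every integer $s$ with $0\leq s\leq r-2$, $N_m$ is a linear combination with integer coefficients of the three terms $N_{a(s+2)+b}$, $N_{a(s+1)+b}$, $N_{as+b}$; in particular there exist integers $\alpha,\beta,\gamma$ with $$N_m=\alpha N_{2a+b}+\beta N_{a+b}+\gamma N_b.$$
   Context: The Narayana numbers $(N_r)_{r\in\mathbb{Z}}$ are defined by $N_0=0$, $N_1=N_2=1$ and $N_r=N_{r-1}+N_{r-3}$ for all integers $r$ (used in both directions). In the paper's language, the terms $N_b,N_{a+b},N_{2a+b},\dots$ are the successive entries of the $b$-th column of the table obtained by writing $N_1,N_2,N_3,\dots$ in rows of length $a$. -}

module Defs where

open import Data.Nat using (ℕ; zero; suc)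
open import Data.Integer using (ℤ; +_; -[1+_]; _+_; _-_)
open import Data.Product using (_×_; _,_; proj₁)

-- (N_n , N_{n+1} , N_{n+2}) for n : ℕ, via N_r = N_{r-1} + N_{r-3}
fwd : ℕ → ℤ × ℤ × ℤ
fwd zero = (+ 0 , + 1 , + 1)
fwd (suc n) with fwd n
... | (x , y , z) = (y , z , z + x)

-- (N_{-k} , N_{-k+1} , N_{-k+2}) for k : ℕ, using N_{r-3} = N_r - N_{r-1}
bwd : ℕ → ℤ × ℤ × ℤ
bwd zero = (+ 0 , + 1 , + 1)
bwd (suc k) with bwd k
... | (x , y , z) = (z - y , x , y)

N : ℤ → ℤ
N (+ n) = proj₁ (fwd n)
N -[1+ k ] = proj₁ (bwd (suc k))

private
  open import Relation.Binary.PropositionalEquality using (_≡_; refl)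
  t1 : N (+ 10) ≡ + 19
  t1 = refl
  t2 : N -[1+ 0 ] ≡ + 0
  t2 = refl
  t3 : N -[1+ 1 ] ≡ + 1
  t3 = refl
  t4 : N -[1+ 2 ] ≡ + 0
  t4 = refl

-- Columns of the Narayana table satisfy a third-order linear recurrence.
--
-- Write F n = N_n and w n = (F n , F (n+1) , F (n+2)).  Unrolling
-- N_r = N_{r-1} + N_{r-3} gives an integer matrix M_a with w (n + a) = M_a w n,
-- so along a column x, x + a, x + 2a, … the windows are w x, M_a w x,
-- M_a² w x, …  The Cayley–Hamilton theorem for M_a then yields a three-term
-- recurrence with integer coefficients for u k = F (x + k a), and every
-- term of such a sequence is an integer combination of its first three.
--
-- Part one of the theorem is the column through a s + b (only s ≤ r is
-- needed); part two is the case s = 0, where a < m forces r ≥ 0.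
module Submission where

open import Defs
open import Data.Integer using (ℤ; +_; -[1+_]; _+_; _-_; _*_; _≤_; _<_; +≤+; -≤+; ∣_∣)
open import Data.Product using (_×_; Σ; _,_; proj₁)
open import Data.List using (_∷_; [])
open import Data.Nat as ℕ using (ℕ; zero; suc)
open import Data.Empty using (⊥-elim)
open import Relation.Binary.PropositionalEquality
  using (_≡_; refl; sym; trans; cong; cong₂; module ≡-Reasoning)
import Data.Nat.Properties as ℕP
import Data.Integer.Properties as ℤP
open import Data.Integer.Tactic.RingSolver using (solve-∀; solve)

open ≡-Reasoning

Span : ℤ → ℤ → ℤ → ℤ → Set
Span X Y Z v = Σ ℤ (λ α → Σ ℤ (λ β → Σ ℤ (λ γ → v ≡ α * X + β * Y + γ * Z)))

generators-span : ∀ X Y Z → Span X Y Z Z × Span X Y Z Y × Span X Y Z X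
generators-span X Y Z =
  (+ 0 , + 0 , + 1 , solve (X ∷ Y ∷ Z ∷ [])) ,
  (+ 0 , + 1 , + 0 , solve (X ∷ Y ∷ Z ∷ [])) ,
  (+ 1 , + 0 , + 0 , solve (X ∷ Y ∷ Z ∷ []))

span-combination : ∀ {X Y Z u v w} t e d →
  Span X Y Z u → Span X Y Z v → Span X Y Z w → Span X Y Z (t * u - e * v + d * w)
span-combination {X} {Y} {Z} t e d
  (α₁ , β₁ , γ₁ , refl) (α₂ , β₂ , γ₂ , refl) (α₃ , β₃ , γ₃ , refl) =
  t * α₁ - e * α₂ + d * α₃ , t * β₁ - e * β₂ + d * β₃ , t * γ₁ - e * γ₂ + d * γ₃ ,
  solve (t ∷ e ∷ d ∷ α₁ ∷ β₁ ∷ γ₁ ∷ α₂ ∷ β₂ ∷ γ₂ ∷ α₃ ∷ β₃ ∷ γ₃ ∷ X ∷ Y ∷ Z ∷ [])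

span-cong : ∀ {X Y Z v X′ Y′ Z′ v′} → X ≡ X′ → Y ≡ Y′ → Z ≡ Z′ → v ≡ v′ →
  Span X Y Z v → Span X′ Y′ Z′ v′
span-cong refl refl refl refl s = s

Recurrence : (ℕ → ℤ) → ℤ → ℤ → ℤ → Set
Recurrence u t e d = ∀ k → u (3 ℕ.+ k) ≡ t * u (2 ℕ.+ k) - e * u (1 ℕ.+ k) + d * u k

-- Every term of such a sequence is an integer combination of its first
-- three terms; by induction, each window of three consecutive terms is.
recurrence-span : ∀ {u t e d} → Recurrence u t e d →
  ∀ k → Span (u 2) (u 1) (u 0) (u k)
recurrence-span {u} {t} {e} {d} rec k = proj₁ (window-span k)
  where
  Spanned : ℤ → Set
  Spanned = Span (u 2) (u 1) (u 0)

  window-span : ∀ k → Spanned (u k) × Spanned (u (1 ℕ.+ k)) × Spanned (u (2 ℕ.+ k))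
  window-span zero = generators-span (u 2) (u 1) (u 0)
  window-span (suc k) =
    let (s₀ , s₁ , s₂) = window-span k
    in s₁ , s₂ , span-cong refl refl refl (sym (rec k)) (span-combination t e d s₂ s₁ s₀)

Vec3 : Set
Vec3 = ℤ × ℤ × ℤ

-- A 3×3 matrix, given by its three rows.
Mat3 : Set
Mat3 = Vec3 × Vec3 × Vec3

dot : Vec3 → Vec3 → ℤ
dot (p , q , r) (x , y , z) = p * x + q * y + r * z

infixr 7 _·_
_·_ : Mat3 → Vec3 → Vec3
(r₀ , r₁ , r₂) · v = dot r₀ v , dot r₁ v , dot r₂ v

trace : Mat3 → ℤ
trace ((a , _ , _) , (_ , e , _) , (_ , _ , i)) = a + e + i

-- Sum of the principal 2×2 minors: the middle coefficient of the
-- characteristic polynomial λ³ - trace λ² + minors λ - det.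
minors : Mat3 → ℤ
minors ((a , b , c) , (d , e , f) , (g , h , i)) =
  (a * e - b * d) + (a * i - c * g) + (e * i - f * h)

det : Mat3 → ℤ
det ((a , b , c) , (d , e , f) , (g , h , i)) =
  a * (e * i - f * h) - b * (d * i - f * g) + c * (d * h - e * g)

-- Cayley–Hamilton, M³ = trace M · M² - minors M · M + det M · I, applied to a
-- vector and read off in the first coordinate (all that is needed below).
cayley-hamilton : ∀ M v → proj₁ (M · M · M · v)
  ≡ trace M * proj₁ (M · M · v) - minors M * proj₁ (M · v) + det M * proj₁ v
cayley-hamilton ((a , b , c) , (d , e , f) , (g , h , i)) (x , y , z) =
  expanded a b c d e f g h i x y z
  where
  expanded : ∀ a b c d e f g h i x y z →
    let x₁ = a * x + b * y + c * z ; y₁ = d * x + e * y + f * z ; z₁ = g * x + h * y + i * z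
        x₂ = a * x₁ + b * y₁ + c * z₁ ; y₂ = d * x₁ + e * y₁ + f * z₁ ; z₂ = g * x₁ + h * y₁ + i * z₁
    in a * x₂ + b * y₂ + c * z₂
       ≡ (a + e + i) * x₂
         - ((a * e - b * d) + (a * i - c * g) + (e * i - f * h)) * x₁
         + (a * (e * i - f * h) - b * (d * i - f * g) + c * (d * h - e * g)) * x
  expanded = solve-∀

F : ℕ → ℤ
F n = N (+ n)

window : ℕ → Vec3
window n = F n , F (1 ℕ.+ n) , F (2 ℕ.+ n)

-- If F m = p F n + q F (n+1) + r F (n+2), then F (m+1) = advance (p,q,r) · w n,
-- because F (n+3) = F (n+2) + F n.
advance : Vec3 → Vec3
advance (p , q , r) = r , p , q + r

advance-dot : ∀ c n → dot c (window (suc n)) ≡ dot (advance c) (window n)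
advance-dot (p , q , r) n = regroup p q r (F n) (F (1 ℕ.+ n)) (F (2 ℕ.+ n))
  where
  regroup : ∀ p q r x y z → p * y + q * z + r * (z + x) ≡ r * x + p * y + (q + r) * z
  regroup = solve-∀

shift-row : ℕ → Vec3
shift-row zero = + 1 , + 0 , + 0
shift-row (suc a) = advance (shift-row a)

shift : ∀ a n → F (a ℕ.+ n) ≡ dot (shift-row a) (window n)
shift zero n = first-coordinate (F n) (F (1 ℕ.+ n)) (F (2 ℕ.+ n))
  where
  first-coordinate : ∀ x y z → x ≡ + 1 * x + + 0 * y + + 0 * z
  first-coordinate = solve-∀
shift (suc a) n = begin
  F (suc a ℕ.+ n)                       ≡⟨ cong F (sym (ℕP.+-suc a n)) ⟩
  F (a ℕ.+ suc n)                       ≡⟨ shift a (suc n) ⟩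
  dot (shift-row a) (window (suc n))    ≡⟨ advance-dot (shift-row a) n ⟩
  dot (shift-row (suc a)) (window n)    ∎

shift-matrix : ℕ → Mat3
shift-matrix a = shift-row a , shift-row (1 ℕ.+ a) , shift-row (2 ℕ.+ a)

window-shift : ∀ a n → window (a ℕ.+ n) ≡ shift-matrix a · window n
window-shift a n =
  cong₂ _,_ (shift a n) (cong₂ _,_ (shift (1 ℕ.+ a) n) (shift (2 ℕ.+ a) n))

column : ℕ → ℕ → ℕ → ℕ
column x a k = k ℕ.* a ℕ.+ x

column-recurrence : ∀ a x → let M = shift-matrix a in
  Recurrence (λ k → F (column x a k)) (trace M) (minors M) (det M)
column-recurrence a x k = begin
  F (column x a (3 ℕ.+ k))
    ≡⟨ cong proj₁ w₃ ⟩
  proj₁ (M · M · M · w k)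
    ≡⟨ cayley-hamilton M (w k) ⟩
  trace M * proj₁ (M · M · w k) - minors M * proj₁ (M · w k) + det M * F (column x a k)
    ≡⟨ sym (cong₂ (λ p q → trace M * p - minors M * q + det M * F (column x a k))
                  (cong proj₁ w₂) (cong proj₁ w₁)) ⟩
  trace M * F (column x a (2 ℕ.+ k)) - minors M * F (column x a (1 ℕ.+ k))
    + det M * F (column x a k) ∎
  where
  M : Mat3
  M = shift-matrix a

  w : ℕ → Vec3
  w k = window (column x a k)

  step : ∀ k → w (suc k) ≡ M · w k
  step k = trans (cong window (ℕP.+-assoc a (k ℕ.* a) x)) (window-shift a (column x a k))

  w₁ : w (1 ℕ.+ k) ≡ M · w k
  w₁ = step k
  w₂ : w (2 ℕ.+ k) ≡ M · M · w k
  w₂ = trans (step (1 ℕ.+ k)) (cong (M ·_) w₁)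
  w₃ : w (3 ℕ.+ k) ≡ M · M · M · w k
  w₃ = trans (step (2 ℕ.+ k)) (cong (M ·_) w₂)

column-span : ∀ a x k →
  Span (F (column x a 2)) (F (column x a 1)) (F (column x a 0)) (F (column x a k))
column-span a x = recurrence-span {t = trace M} {e = minors M} {d = det M} (column-recurrence a x)
  where
  M : Mat3
  M = shift-matrix a

column-index : ∀ a s b j → + column (a ℕ.* s ℕ.+ b) a j ≡ + a * (+ s + + j) + + b
column-index a s b j = begin
  + (j ℕ.* a ℕ.+ (a ℕ.* s ℕ.+ b))     ≡⟨ ℤP.pos-+ (j ℕ.* a) (a ℕ.* s ℕ.+ b) ⟩
  + (j ℕ.* a) + + (a ℕ.* s ℕ.+ b)     ≡⟨ cong₂ _+_ (ℤP.pos-* j a) (ℤP.pos-+ (a ℕ.* s) b) ⟩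
  + j * + a + (+ (a ℕ.* s) + + b)     ≡⟨ cong (λ p → + j * + a + (p + + b)) (ℤP.pos-* a s) ⟩
  + j * + a + (+ a * + s + + b)       ≡⟨ regroup (+ a) (+ s) (+ b) (+ j) ⟩
  + a * (+ s + + j) + + b             ∎
  where
  regroup : ∀ a s b j → j * a + (a * s + b) ≡ a * (s + j) + b
  regroup = solve-∀

-- For s ≤ r, N_{a r + b} is an integer combination of N_{a(s+2)+b},
-- N_{a(s+1)+b} and N_{a s+b}: it is entry r - s of the column through a s + b.
later-entry-span : ∀ (a b s : ℕ) r → + s ≤ r →
  Span (N (+ a * (+ s + + 2) + + b)) (N (+ a * (+ s + + 1) + + b)) (N (+ a * + s + + b))
       (N (+ a * r + + b))
later-entry-span a b s r s≤r =
  span-cong (entry 2) (entry 1)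
    (trans (entry 0) (cong (λ p → N (+ a * p + + b)) (ℤP.+-identityʳ (+ s))))
    (trans (entry k) (cong (λ p → N (+ a * p + + b)) s+k≡r))
    (column-span a (a ℕ.* s ℕ.+ b) k)
  where
  k : ℕ
  k = ∣ r - + s ∣

  s+k≡r : + s + + k ≡ r
  s+k≡r = trans (cong (λ p → + s + p) (ℤP.0≤i⇒+∣i∣≡i (ℤP.i≤j⇒0≤j-i s≤r))) (cancel (+ s) r)
    where
    cancel : ∀ i j → i + (j - i) ≡ j
    cancel = solve-∀

  entry : ∀ j → F (column (a ℕ.* s ℕ.+ b) a j) ≡ N (+ a * (+ s + + j) + + b)
  entry j = cong N (column-index a s b j)

-- With a ≥ 0, a < a r + b and b ≤ a force r ≥ 0, since r < 0 gives a r + b ≤ b.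
multiplier-nonNeg : ∀ (a : ℕ) b r → b ≤ + a → + a < + a * r + b → + 0 ≤ r
multiplier-nonNeg a b (+ n) _ _ = +≤+ ℕ.z≤n
multiplier-nonNeg a b -[1+ n ] b≤a a<m =
  ⊥-elim (ℤP.<-irrefl refl (ℤP.<-≤-trans a<m (ℤP.≤-trans m≤b b≤a)))
  where
  -- a r ≤ a · 0 = 0, since a ≥ 0 and r ≤ 0
  m≤b : + a * -[1+ n ] + b ≤ b
  m≤b = ℤP.≤-trans (ℤP.+-monoˡ-≤ b (ℤP.*-monoˡ-≤-nonNeg (+ a) -≤+))
          (ℤP.≤-reflexive (trans (cong (_+ b) (ℤP.*-zeroʳ (+ a))) (ℤP.+-identityˡ b)))

theorem5 : (a b r m : ℤ) → m ≡ a * r + b → + 1 ≤ b → b ≤ a → a < m →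
    ((s : ℤ) → + 0 ≤ s → s ≤ r - + 2 →
      Σ ℤ (λ α → Σ ℤ (λ β → Σ ℤ (λ γ →
        N m ≡ α * N (a * (s + + 2) + b) + β * N (a * (s + + 1) + b) + γ * N (a * s + b)))))
    × Σ ℤ (λ α → Σ ℤ (λ β → Σ ℤ (λ γ →
        N m ≡ α * N (+ 2 * a + b) + β * N (a + b) + γ * N b)))
theorem5 (+ a) (+ b) r m m≡ar+b _ b≤a a<m = any-column , first-column
  where
  any-column : (s : ℤ) → + 0 ≤ s → s ≤ r - + 2 → Span
    (N (+ a * (s + + 2) + + b)) (N (+ a * (s + + 1) + + b)) (N (+ a * s + + b)) (N m)
  any-column (+ s) _ s≤r-2 =
    span-cong refl refl refl (cong N (sym m≡ar+b))
      (later-entry-span a b s r (ℤP.≤-trans s≤r-2 (ℤP.i-j≤i r (+ 2))))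
  any-column -[1+ _ ] () _

  first-column : Span (N (+ 2 * + a + + b)) (N (+ a + + b)) (N (+ b)) (N m)
  first-column =
    span-cong (cong N (regroup₂ (+ a) (+ b))) (cong N (regroup₁ (+ a) (+ b)))
      (cong N (regroup₀ (+ a) (+ b))) (cong N (sym m≡ar+b))
      (later-entry-span a b 0 r
        (multiplier-nonNeg a (+ b) r b≤a (ℤP.<-≤-trans a<m (ℤP.≤-reflexive m≡ar+b))))
    where
    regroup₂ : ∀ a b → a * (+ 0 + + 2) + b ≡ + 2 * a + b
    regroup₂ = solve-∀
    regroup₁ : ∀ a b → a * (+ 0 + + 1) + b ≡ a + b
    regroup₁ = solve-∀
    regroup₀ : ∀ a b → a * + 0 + b ≡ b
    regroup₀ = solve-∀
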